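{- Let $\mathcal{N}$ be a MEMDP with environment set $I$ and let $\langle s_1,j,J_1\rangle a_1\langle s_2,j,J_2\rangle\dots\langle s_n,j,J_n\rangle$ be a path of the BOMDP $\mathcal{G}_{\mathcal{N}}$ with $j\in J_1$. Then $J_n\neq\emptyset$, and for every $i\in I$: the sequence $s_1a_1s_2\dots s_n$ is a path of the MDP $\mathcal{N}_i$ if and only if $i\in J_1\cap J_n$.
   Context: An MDP is $\langle S,A,\iota,p\rangle$ with finite $S,A$, initial distribution $\iota$, and total $p\colon S\times A\to\mathit{Dist}(S)$; a path of it is a sequence $s_1a_1s_2\dots s_n$ with $\iota(s_1)>0$ and $p(s_k,a_k)(s_{k+1})>0$ for all $k<n$. A MEMDP $\mathcal{N}=\langle S,A,\iota,\{p_i\}_{i\in I}\rangle$ has finite environment set $I$ and transition functions $p_i$; $\mathcal{N}_i=\langle S,A,\iota,p_i\rangle$. For $J\subseteq I$ let $\mathsf{Up}(J,s,a,s')=\{i\in J: p_i(s,a)(s')>0\}$. The BOMDP $\mathcal{G}_{\mathcal{N}}$ is the MDP with states $S\times I\times 2^I$, actions $A$, initial distribution $\iota'(\langle s,j,I\rangle)=\iota(s)/|I|$ (zero elsewhere), and transitions $p'(\langle s,j,J\rangle,a)(\langle s',j,J'\rangle)=p_j(s,a)(s')$ if $J'=\mathsf{Up}(J,s,a,s')$ and $0$ otherwise (with observation function $O(\langle s,j,J\rangle)=\langle s,J\rangle$).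
   Formalization: The initial distribution ι and the transition functions $p_i$ of the MEMDP take values in ℚ. -}

module Defs where

open import Data.Nat as ℕ using (ℕ; zero; suc)
open import Data.Fin using (Fin; zero; suc; inject₁; fromℕ)
open import Data.Fin.Subset using (Subset; ⊤)
open import Data.Bool using (Bool; true; false; _∧_)
open import Data.Integer using (+_)
open import Data.Rational using (ℚ; 0ℚ; 1ℚ; _+_; _*_; _/_; _≤_; _<_)
open import Data.Rational.Properties using (_<?_)
open import Data.Vec using (tabulate)
import Data.Vec.Properties as VecP
import Data.Bool.Properties as BoolP
open import Data.Fin.Properties using () renaming (_≟_ to _≟ᶠ_)
open import Data.Product using (_×_; _,_)
open import Relation.Nullary using (Dec; yes; no; does)
open import Relation.Binary.PropositionalEquality using (_≡_)

∑ : ∀ {n} → (Fin n → ℚ) → ℚ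
∑ {zero}  f = 0ℚ
∑ {suc n} f = f zero + ∑ (λ x → f (suc x))

IsDist : ∀ {n} → (Fin n → ℚ) → Set
IsDist {n} f = ((x : Fin n) → 0ℚ ≤ f x) × ∑ f ≡ 1ℚ

-- MEMDP with states Fin m, actions Fin l, environments I = Fin k.
record MEMDP (m l k : ℕ) : Set where
  field
    ι      : Fin m → ℚ
    ι-dist : IsDist ι
    p      : Fin k → Fin m → Fin l → Fin m → ℚ
    p-dist : ∀ i s a → IsDist (p i s a)

-- Paths s₁ a₁ s₂ … a_n s_{n+1} (n steps, suc n states) w.r.t. an
-- initial weighting ι and transition weighting p on arbitrary types.
IsPath : {St Act : Set} → (St → ℚ) → (St → Act → St → ℚ) →
         (n : ℕ) → (Fin (suc n) → St) → (Fin n → Act) → Set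
IsPath ι p n s a =
  (0ℚ < ι (s zero)) × ((t : Fin _) → 0ℚ < p (s (inject₁ t)) (a t) (s (suc t)))

module _ {m l k : ℕ} (N : MEMDP m l k) where
  open MEMDP N

  ιᵢ : Fin m → ℚ
  ιᵢ = ι

  pᵢ : Fin k → Fin m → Fin l → Fin m → ℚ
  pᵢ i = p i

  Up : Subset k → Fin m → Fin l → Fin m → Subset k
  Up J s a s' = tabulate λ i → Data.Vec.lookup J i ∧ does (0ℚ <? p i s a s')

  BState : Set
  BState = Fin m × Fin k × Subset k

  -- Initial distribution ι'(⟨s,j,I⟩) = ι(s)/|I|, zero elsewhere.
  ι' : BState → ℚ
  ι' (s , j , J) with VecP.≡-dec BoolP._≟_ J ⊤
  ... | no  _ = 0ℚ
  ... | yes _ = div j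
    where
      div : Fin k → ℚ
      div (zero {n = k'}) = ι s * (+ 1 / suc k')
      div (suc {n = k'} _) = ι s * (+ 1 / suc k')

  p' : BState → Fin l → BState → ℚ
  p' (s , j , J) a (s' , j' , J') with j' ≟ᶠ j | VecP.≡-dec BoolP._≟_ J' (Up J s a s')
  ... | yes _ | yes _ = p j s a s'
  ... | _     | _     = 0ℚ

module Submission where

open import Defs
open import Data.Nat using (ℕ; suc; zero)
open import Data.Fin using (Fin; zero; suc; fromℕ; inject₁)
open import Data.Fin.Subset using (Subset; _∈_; _∩_; ⊤) renaming (⊥ to ∅)
open import Data.Fin.Subset.Properties using (∈⊤; ∉⊥; x∈p∩q⁺; x∈p∩q⁻)
open import Data.Bool using (Bool; true; false; _∧_)
import Data.Bool.Properties as Bool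
open import Data.Empty using (⊥-elim)
open import Data.Product using (_×_; _,_; proj₁; proj₂)
open import Data.Rational using (ℚ; 0ℚ; _<_; _≤_; _*_)
open import Data.Rational.Properties using (_<?_; <-cmp; <-irrefl; ≤-<-trans; *-zeroˡ)
open import Data.Vec using (lookup; tabulate)
open import Data.Vec.Properties using (lookup∘tabulate; []=⇒lookup; lookup⇒[]=)
import Data.Vec.Properties as Vec
open import Data.Fin.Properties using () renaming (_≟_ to _≟ᶠ_)
open import Function.Bundles using (_⇔_; mk⇔; Equivalence)
open import Relation.Binary.Definitions using (tri<; tri≈; tri>)
open import Relation.Binary.PropositionalEquality using (_≡_; _≢_; refl; sym; trans; subst)
open import Relation.Nullary using (Dec; yes; no; does)

-- The belief J of a BOMDP state only shrinks along a path, and it loses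
-- environment i exactly at the first step that is impossible in N_i; hence
-- J_n = J_1 ∩ {i : every step is possible in N_i}. The initial belief is the
-- full set I, and the true environment j never leaves it.

∧-does≡true⇔ : ∀ {Q : Set} b (d : Dec Q) → (b ∧ does d) ≡ true ⇔ (b ≡ true × Q)
∧-does≡true⇔ true  (yes q) = mk⇔ (λ _ → refl , q) (λ _ → refl)
∧-does≡true⇔ true  (no ¬q) = mk⇔ (λ ()) (λ (_ , q) → ⊥-elim (¬q q))
∧-does≡true⇔ false d       = mk⇔ (λ ()) (λ ())

∈-tabulate⇔ : ∀ {k} (f : Fin k → Bool) i → i ∈ tabulate f ⇔ f i ≡ true
∈-tabulate⇔ f i = mk⇔
  (λ i∈ → trans (sym (lookup∘tabulate f i)) ([]=⇒lookup i∈))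
  (λ fi → lookup⇒[]= i (tabulate f) (trans (lookup∘tabulate f i) fi))

0≤x⇒0<x*y⇒0<x : ∀ x y → 0ℚ ≤ x → 0ℚ < x * y → 0ℚ < x
0≤x⇒0<x*y⇒0<x x y 0≤x 0<xy with <-cmp 0ℚ x
... | tri< 0<x _ _    = 0<x
... | tri≈ _ refl _   = ⊥-elim (<-irrefl (sym (*-zeroˡ y)) 0<xy)
... | tri> _ _ x<0    = ⊥-elim (<-irrefl refl (≤-<-trans 0≤x x<0))

PositiveSteps : {St Act : Set} → (St → Act → St → ℚ) →
                (n : ℕ) → (Fin (suc n) → St) → (Fin n → Act) → Set
PositiveSteps p n s a = (t : Fin n) → 0ℚ < p (s (inject₁ t)) (a t) (s (suc t))

module _ {m l k : ℕ} (N : MEMDP m l k) where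
  open MEMDP N

  FollowsUp : (n : ℕ) → (Fin (suc n) → Fin m) → (Fin n → Fin l) →
              (Fin (suc n) → Subset k) → Set
  FollowsUp n s a J =
    (t : Fin n) → J (suc t) ≡ Up N (J (inject₁ t)) (s (inject₁ t)) (a t) (s (suc t))

  ∈-Up⇔ : ∀ J s a s' i → i ∈ Up N J s a s' ⇔ (i ∈ J × 0ℚ < p i s a s')
  ∈-Up⇔ J s a s' i = mk⇔
    (λ i∈ → let J[i] , 0<p = to ∧-does (to ∈-tabulate i∈) in lookup⇒[]= i J J[i] , 0<p)
    (λ (i∈J , 0<p) → from ∈-tabulate (from ∧-does ([]=⇒lookup i∈J , 0<p)))
    where
      open Equivalence
      ∧-does : (lookup J i ∧ does (0ℚ <? p i s a s')) ≡ true ⇔ (lookup J i ≡ true × 0ℚ < p i s a s')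
      ∧-does = ∧-does≡true⇔ (lookup J i) (0ℚ <? p i s a s')
      ∈-tabulate : i ∈ Up N J s a s' ⇔ (lookup J i ∧ does (0ℚ <? p i s a s')) ≡ true
      ∈-tabulate = ∈-tabulate⇔ (λ i → lookup J i ∧ does (0ℚ <? p i s a s')) i

  ι'-positive⇒ : ∀ s j J → 0ℚ < ι' N (s , j , J) → J ≡ ⊤ × 0ℚ < ι s
  ι'-positive⇒ s j J 0<ι' with Vec.≡-dec Bool._≟_ J ⊤
  ... | no _     = ⊥-elim (<-irrefl refl 0<ι')
  -- ι' divides by |I| through a case split on j, so it only reduces after one.
  ... | yes J≡⊤ with j
  ...   | zero  = J≡⊤ , 0≤x⇒0<x*y⇒0<x _ _ (proj₁ ι-dist s) 0<ι'
  ...   | suc _ = J≡⊤ , 0≤x⇒0<x*y⇒0<x _ _ (proj₁ ι-dist s) 0<ι'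

  p'-positive⇒ : ∀ s j J a s' j' J' → 0ℚ < p' N (s , j , J) a (s' , j' , J') →
                 J' ≡ Up N J s a s' × 0ℚ < p j s a s'
  p'-positive⇒ s j J a s' j' J' 0<p' with j' ≟ᶠ j | Vec.≡-dec Bool._≟_ J' (Up N J s a s')
  ... | yes _ | yes J'≡Up = J'≡Up , 0<p'
  ... | yes _ | no _      = ⊥-elim (<-irrefl refl 0<p')
  ... | no _  | _         = ⊥-elim (<-irrefl refl 0<p')

  ∈-last⇔ : ∀ n s a J → FollowsUp n s a J → ∀ i →
            i ∈ J (fromℕ n) ⇔ (i ∈ J zero × PositiveSteps (p i) n s a)
  ∈-last⇔ zero    s a J follows i = mk⇔ (λ i∈ → i∈ , λ ()) proj₁
  ∈-last⇔ (suc n) s a J follows i = mk⇔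
    (λ i∈Jₙ → let i∈J₁ , steps = to IH i∈Jₙ
                  i∈J₀ , step₀ = to first (subst (i ∈_) (follows zero) i∈J₁)
              in i∈J₀ , λ { zero → step₀ ; (suc t) → steps t })
    (λ (i∈J₀ , steps) →
      from IH (subst (i ∈_) (sym (follows zero)) (from first (i∈J₀ , steps zero)) ,
               λ t → steps (suc t)))
    where
      open Equivalence
      IH : i ∈ J (suc (fromℕ n)) ⇔
           (i ∈ J (suc zero) × PositiveSteps (p i) n (λ t → s (suc t)) (λ t → a (suc t)))
      IH = ∈-last⇔ n (λ t → s (suc t)) (λ t → a (suc t)) (λ t → J (suc t))
                   (λ t → follows (suc t)) i
      first : i ∈ Up N (J zero) (s zero) (a zero) (s (suc zero)) ⇔
              (i ∈ J zero × 0ℚ < p i (s zero) (a zero) (s (suc zero)))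
      first = ∈-Up⇔ (J zero) (s zero) (a zero) (s (suc zero)) i

lemma2 : {m l k : ℕ} (N : MEMDP m l k) (n : ℕ) (s : Fin (suc n) → Fin m)
    (a : Fin n → Fin l) (j : Fin k) (J : Fin (suc n) → Subset k) →
    IsPath (ι' N) (p' N) n (λ t → (s t , j , J t)) a →
    j ∈ J zero →
    (J (fromℕ n) ≢ ∅) ×
    ((i : Fin k) → IsPath (ιᵢ N) (pᵢ N i) n s a ⇔ (i ∈ (J zero ∩ J (fromℕ n))))
lemma2 N n s a j J (0<ι' , 0<p') j∈J₀ =
  (λ Jₙ≡∅ → ∉⊥ (subst (j ∈_) Jₙ≡∅ j∈Jₙ)) ,
  λ i → mk⇔
    (λ (_ , steps) → x∈p∩q⁺ (all∈J₀ i , from (∈-last⇔ N n s a J follows i) (all∈J₀ i , steps)))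
    (λ i∈ → 0<ι , proj₂ (to (∈-last⇔ N n s a J follows i) (proj₂ (x∈p∩q⁻ _ _ i∈))))
  where
    open Equivalence
    J₀≡⊤ : J zero ≡ ⊤
    J₀≡⊤ = proj₁ (ι'-positive⇒ N (s zero) j (J zero) 0<ι')
    0<ι : 0ℚ < MEMDP.ι N (s zero)
    0<ι = proj₂ (ι'-positive⇒ N (s zero) j (J zero) 0<ι')
    follows : FollowsUp N n s a J
    follows t = proj₁ (p'-positive⇒ N _ j _ (a t) _ j _ (0<p' t))
    j-steps : PositiveSteps (MEMDP.p N j) n s a
    j-steps t = proj₂ (p'-positive⇒ N _ j _ (a t) _ j _ (0<p' t))
    all∈J₀ : ∀ i → i ∈ J zero
    all∈J₀ i = subst (i ∈_) (sym J₀≡⊤) ∈⊤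
    j∈Jₙ : j ∈ J (fromℕ n)
    j∈Jₙ = from (∈-last⇔ N n s a J follows j) (j∈J₀ , j-steps)
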